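{- Given any sequence of $t$ updates after which the graph is empty, the total cost of all final epochs is deterministically $O(t)$.
   Context: Setting: $G=(V,E)$ is a dynamic graph on a fixed set $V$ of $n$ vertices that starts with no edges and undergoes a sequence of updates, each the insertion or deletion of one edge; it is assumed that the graph has no edges after the last update. A fixed integer $\Delta>0$ upper-bounds the maximum degree of $G$ at all times, and $\mathcal{C}=\{1,\dots,\Delta+1\}$ is the set of colors. Let $L=\lceil\log_3(n-1)\rceil-1$. The algorithm maintains a coloring $\chi:V\to\mathcal{C}$ and a level $\ell(v)\in\{ -1,0,\dots,L\}$ for each vertex $v$. For an edge $uv$, $u$ is an up-neighbor of $v$ if $\ell(u)\ge\ell(v)$ and a down-neighbor of $v$ if $\ell(u)<\ell(v)$. For a level $k$, $\phi_v(k)$ is the number of neighbors $u$ of $v$ with $\ell(u)<k$. A color $c$ is blank for $v$ if no neighbor of $v$ has color $c$, and unique for $v$ if no up-neighbor of $v$ has color $c$ and exactly one down-neighbor of $v$ has color $c$. Algorithm: initially every vertex is at level $-1$ with an arbitrary color. A deletion changes nothing. On insertion of an edge $uv$: if $\chi(u)\neq\chi(v)$ nothing changes; otherwise let $x$ be the endpoint among $u,v$ that was recolored most recently, and repeat $x\leftarrow\texttt{recolor}(x)$ until $x=\mathrm{NULL}$. The procedure $\texttt{recolor}(x)$: if $\phi_x(\ell(x)+1)<3^{\ell(x)+2}$, call $\texttt{det-color}(x)$, which assigns to $x$ a deterministically chosen blank color, sets $\ell(x)=-1$, and then return NULL. Otherwise call $\texttt{rand-color}(x)$, which: lets $\ell'$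 be the minimum level $\ell'>\ell(x)$ with $\phi_x(\ell'+1)<3^{\ell'+2}$ and sets $\ell(x)=\ell'$; picks uniformly at random a color $c$ among the colors that are blank or unique for $x$ and sets $\chi(x)=c$; returns NULL if $c$ is blank for $x$, and otherwise returns the unique down-neighbor $y$ of $x$ with $\chi(y)=c$. The implementation is such that $\texttt{det-color}(x)$ takes $O(3^{\ell(x)})$ time ($\ell(x)$ the level at the start of the call) and $\texttt{rand-color}(x)$ takes $O(3^{\ell'})$ time ($\ell'$ the new level). Epochs: an epoch $\mathcal{E}$ of a vertex $v=v(\mathcal{E})$ is a maximal time interval during which $v$ keeps the same color; it starts with a call to $\texttt{recolor}(v)$ and ends immediately before the next call to $\texttt{recolor}(v)$, if any. Its level $\ell(\mathcal{E})$ is the (constant) level of $v$ during $\mathcal{E}$. An epoch is final if it is not ended by a call to $\texttt{recolor}(v)$. The cost $c(\mathcal{E})$ of an epoch is the running time of the call to $\texttt{recolor}(v(\mathcal{E}))$ that starts it, where in addition the cost of every epoch at level $-1$ is reassigned to the previous epoch of the same vertex; with this convention $c(\mathcal{E})=O(3^{\ell(\mathcal{E})})$ for every epoch $\mathcal{E}$. -}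

module Defs where

open import Data.Nat using (ℕ; zero; suc; _+_; _*_; _∸_; _^_; _≤_; _<_; _<?_)
open import Data.Bool using (Bool; true; false; if_then_else_; _∧_; _∨_)
open import Data.Fin using (Fin; _≟_)
import Data.Fin as F
open import Data.List using (List; []; _∷_; foldl)
open import Data.Product using (_×_)
open import Data.Maybe using (Maybe; nothing; just)
open import Relation.Nullary using (¬_)
open import Relation.Nullary.Decidable using (⌊_⌋)
open import Relation.Binary.PropositionalEquality using (_≡_; _≢_)

count : ∀ {n} → (Fin n → Bool) → ℕ
count {zero}  p = 0
count {suc n} p = (if p F.zero then 1 else 0) + count (λ i → p (F.suc i))

sumFin : ∀ {n} → (Fin n → ℕ) → ℕ
sumFin {zero}  f = 0
sumFin {suc n} f = f F.zero + sumFin (λ i → f (F.suc i))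

upd : ∀ {n} {A : Set} → (Fin n → A) → Fin n → A → Fin n → A
upd f x a y = if ⌊ y ≟ x ⌋ then a else f y

-- Graphs on vertex set Fin n, as symmetric adjacency functions

Adj : ℕ → Set
Adj n = Fin n → Fin n → Bool

emptyG : ∀ {n} → Adj n
emptyG _ _ = false

setEdge : ∀ {n} → Adj n → Fin n → Fin n → Bool → Adj n
setEdge G u v b a c =
  if (⌊ a ≟ u ⌋ ∧ ⌊ c ≟ v ⌋) ∨ (⌊ a ≟ v ⌋ ∧ ⌊ c ≟ u ⌋) then b else G a c

deg : ∀ {n} → Adj n → Fin n → ℕ
deg G w = count (G w)

data Update (n : ℕ) : Set where
  ins : Fin n → Fin n → Update n
  del : Fin n → Fin n → Update n

applyU : ∀ {n} → Adj n → Update n → Adj n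
applyU G (ins u v) = setEdge G u v true
applyU G (del u v) = setEdge G u v false

data Valid {n : ℕ} (Δ : ℕ) : Adj n → List (Update n) → Set where
  nilV : ∀ {G} → Valid Δ G []
  insV : ∀ {G u v us} → u ≢ v → G u v ≡ false →
         (∀ w → deg (setEdge G u v true) w ≤ Δ) →
         Valid Δ (setEdge G u v true) us → Valid Δ G (ins u v ∷ us)
  delV : ∀ {G u v us} → G u v ≡ true →
         Valid Δ (setEdge G u v false) us → Valid Δ G (del u v ∷ us)

EndsEmpty : ∀ {n} → List (Update n) → Set
EndsEmpty {n} us = ∀ (a b : Fin n) → foldl applyU emptyG us a b ≡ false

-- Levels are ENCODED: lvl v = ℓ(v) + 1, so the
-- paper's level -1 is 0 and level ℓ ≥ 0 is ℓ+1.
-- Colors: Fin (suc Δ) ≅ {1,…,Δ+1}.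
-- stamp v : time of the most recent recolor call on v (0 = never).
-- ecost v : cost c(ℰ) of the current epoch of v (0 if v has none yet).

record St (n Δ : ℕ) : Set where
  constructor mkSt
  field
    adj   : Adj n
    col   : Fin n → Fin (suc Δ)
    lvl   : Fin n → ℕ
    stamp : Fin n → ℕ
    clock : ℕ
    ecost : Fin n → ℕ
open St public

initSt : ∀ {n Δ} → (Fin n → Fin (suc Δ)) → St n Δ
initSt c0 = mkSt emptyG c0 (λ _ → 0) (λ _ → 0) 1 (λ _ → 0)

-- φ_x(k) with k encoded as K = k+1: number of neighbors u with lvl u < K
phiE : ∀ {n Δ} → St n Δ → Fin n → ℕ → ℕ
phiE s x K = count (λ u → adj s x u ∧ ⌊ lvl s u <? K ⌋)

-- Ok s x L (L encoded level ℓ+1):  φ_x(ℓ+1) < 3^(ℓ+2)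
Ok : ∀ {n Δ} → St n Δ → Fin n → ℕ → Set
Ok s x L = phiE s x (suc L) < 3 ^ suc L

Blank : ∀ {n Δ} → St n Δ → Fin n → Fin (suc Δ) → Set
Blank s x c = ∀ u → adj s x u ≡ true → col s u ≢ c

Unique : ∀ {n Δ} → St n Δ → Fin n → Fin (suc Δ) → Set
Unique s x c =
  (∀ u → adj s x u ≡ true → lvl s x ≤ lvl s u → col s u ≢ c) ×
  (count (λ u → adj s x u ∧ ⌊ lvl s u <? lvl s x ⌋ ∧ ⌊ col s u ≟ c ⌋) ≡ 1)

setLevel : ∀ {n Δ} → St n Δ → Fin n → ℕ → St n Δ
setLevel s x L = record s { lvl = upd (lvl s) x L }

recol : ∀ {n Δ} → St n Δ → Fin n → Fin (suc Δ) → ℕ → St n Δ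
recol s x c k = record s
  { col = upd (col s) x c
  ; stamp = upd (stamp s) x (clock s)
  ; clock = suc (clock s)
  ; ecost = upd (ecost s) x k }

-- det-color(x): any blank color (the deterministic choice rule is arbitrary),
-- level -1; the cost of a level -1 epoch is reassigned to the previous
-- epoch, so the new epoch carries cost 0.
data DetStep {n Δ} (s : St n Δ) (x : Fin n) : St n Δ → Set where
  detS : (c : Fin (suc Δ)) → Ok s x (lvl s x) → Blank s x c →
         DetStep s x (recol (setLevel s x 0) x c 0)

-- rand-color(x): the random choice is modelled as an arbitrary choice among
-- blank-or-unique colors.  Cost of the new epoch: 3^ℓ' (ℓ' = L' - 1).
data RandStep {n Δ} (s : St n Δ) (x : Fin n) : St n Δ → Maybe (Fin n) → Set where
  randBlank : (L' : ℕ) (c : Fin (suc Δ)) →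
    ¬ Ok s x (lvl s x) → lvl s x < L' → Ok s x L' →
    (∀ m → lvl s x < m → m < L' → ¬ Ok s x m) →
    Blank (setLevel s x L') x c →
    RandStep s x (recol (setLevel s x L') x c (3 ^ (L' ∸ 1))) nothing
  randUnique : (L' : ℕ) (c : Fin (suc Δ)) (y : Fin n) →
    ¬ Ok s x (lvl s x) → lvl s x < L' → Ok s x L' →
    (∀ m → lvl s x < m → m < L' → ¬ Ok s x m) →
    Unique (setLevel s x L') x c →
    adj s x y ≡ true → lvl s y < L' → col s y ≡ c →
    RandStep s x (recol (setLevel s x L') x c (3 ^ (L' ∸ 1))) (just y)

data Chain {n Δ} : St n Δ → Fin n → St n Δ → Set where
  chDet  : ∀ {s x s'} → DetStep s x s' → Chain s x s'
  chStop : ∀ {s x s'} → RandStep s x s' nothing → Chain s x s'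
  chGo   : ∀ {s x s' y s''} → RandStep s x s' (just y) → Chain s' y s'' →
           Chain s x s''

withEdge : ∀ {n Δ} → St n Δ → Fin n → Fin n → Bool → St n Δ
withEdge s u v b = record s { adj = setEdge (adj s) u v b }

-- Run s us s' : processing the updates us from state s can end in state s'
-- (for some outcome of the random choices).
data Run {n Δ} : St n Δ → List (Update n) → St n Δ → Set where
  done    : ∀ {s} → Run s [] s
  delR    : ∀ {s u v us s'} → Run (withEdge s u v false) us s' →
            Run s (del u v ∷ us) s'
  insDiff : ∀ {s u v us s'} → col s u ≢ col s v →
            Run (withEdge s u v true) us s' → Run s (ins u v ∷ us) s'
  -- equal colors: recolor the endpoint recolored most recently (ties: either)
  insSameU : ∀ {s u v us s1 s'} → col s u ≡ col s v → stamp s v ≤ stamp s u →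
            Chain (withEdge s u v true) u s1 → Run s1 us s' →
            Run s (ins u v ∷ us) s'
  insSameV : ∀ {s u v us s1 s'} → col s u ≡ col s v → stamp s u ≤ stamp s v →
            Chain (withEdge s u v true) v s1 → Run s1 us s' →
            Run s (ins u v ∷ us) s'

-- total cost of all final epochs (the current epoch of each vertex at the end)
finalCost : ∀ {n Δ} → St n Δ → ℕ
finalCost s = sumFin (ecost s)

-- Let the potential of a
-- state be  Φ = Σ_v (c(ℰ_v) ∸ deg v),  where ℰ_v is the current epoch of v.
--   * A recolor call that starts an epoch of cost k at a vertex x with
--     k ≤ deg x does not increase Φ (the term of x drops to 0).  Every
--     epoch cost satisfies this: det-color epochs cost 0, and rand-color
--     picks the least admissible level ℓ', so level ℓ'-1 was not admissible,
--     whence 3^ℓ' ≤ φ_x(ℓ') ≤ deg x.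
--   * Inserting an edge only raises degrees, so it does not increase Φ.
--   * Deleting an edge lowers the degree of each endpoint by at most one,
--     so it increases Φ by at most 2.
-- Hence after t updates Φ ≤ Φ(initial) + 2t = 2t.  When the graph is empty
-- at the end, every degree is 0 and Φ is exactly the total final cost.

module Submission where

open import Defs
open import Data.Nat using (ℕ; suc; _*_; _≤_; _<_)
open import Data.Fin using (Fin)
open import Data.List using (List; length)
open import Data.Product using (Σ)

open import Data.Nat using (zero; _+_; _∸_; _^_; z≤n; s≤s)
open import Data.Nat.Properties
  using ( ≤-refl; ≤-trans; ≤-reflexive; +-mono-≤; +-monoˡ-≤; +-monoʳ-≤
        ; +-assoc; +-comm; +-identityʳ; *-suc; m≤m+n; m≤n⇒m≤1+n; m≤n*m; n<1+n; ≮⇒≥; ≤∧≢⇒<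
        ; m≤n+m∸n; m≤n+o⇒m∸n≤o; m≤n⇒m∸n≡0; 0∸n≡0; ∸-monoʳ-≤
        ; +-commutativeSemigroup; module ≤-Reasoning )
import Data.Nat.Properties as ℕ
open import Algebra.Properties.CommutativeSemigroup +-commutativeSemigroup using (interchange)
open import Data.Bool using (Bool; true; false; if_then_else_; _∧_; _∨_; T)
open import Data.Bool.Properties using (T-∧; T-∨; T-≡)
import Data.Fin as F
open import Data.Fin using (_≟_)
open import Data.Fin.Properties using (suc-injective)
open import Data.List using (_∷_; foldl)
open import Data.Product using (_×_; _,_)
open import Data.Sum using (_⊎_; inj₁; inj₂)
open import Data.Empty using (⊥-elim)
open import Function.Base using (_∘_)
open import Function.Bundles using (Equivalence)
open import Relation.Nullary using (¬_; Dec; yes; no)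
open import Relation.Nullary.Decidable using (⌊_⌋; toWitness)
open import Relation.Binary.PropositionalEquality

open Equivalence using (to; from)

count-none : ∀ {n} (f : Fin n → Bool) → (∀ i → f i ≡ false) → count f ≡ 0
count-none {zero}  f none = refl
count-none {suc n} f none rewrite none F.zero =
  count-none (λ i → f (F.suc i)) (λ i → none (F.suc i))

count-mono : ∀ {n} (f g : Fin n → Bool) →
             (∀ i → f i ≡ true → g i ≡ true) → count f ≤ count g
count-mono {zero}  f g f⇒g = z≤n
count-mono {suc n} f g f⇒g with f F.zero in f0 | g F.zero in g0
... | true  | true  = s≤s (count-mono _ _ (λ i → f⇒g (F.suc i)))
... | false | true  = m≤n⇒m≤1+n (count-mono _ _ (λ i → f⇒g (F.suc i)))
... | false | false = count-mono _ _ (λ i → f⇒g (F.suc i))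
... | true  | false with trans (sym (f⇒g F.zero f0)) g0
...   | ()

count-mono-except : ∀ {n} (f g : Fin n → Bool) (p : Fin n) →
                    (∀ i → i ≢ p → f i ≡ true → g i ≡ true) →
                    count f ≤ suc (count g)
count-mono-except {suc n} f g F.zero f⇒g with f F.zero | g F.zero
... | true  | true  = s≤s (m≤n⇒m≤1+n (count-mono _ _ (λ i → f⇒g (F.suc i) λ ())))
... | true  | false = s≤s (count-mono _ _ (λ i → f⇒g (F.suc i) λ ()))
... | false | true  = m≤n⇒m≤1+n (m≤n⇒m≤1+n (count-mono _ _ (λ i → f⇒g (F.suc i) λ ())))
... | false | false = m≤n⇒m≤1+n (count-mono _ _ (λ i → f⇒g (F.suc i) λ ()))
count-mono-except {suc n} f g (F.suc p) f⇒g with f F.zero in f0 | g F.zero in g0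
... | true  | true  = s≤s (count-mono-except _ _ p (λ i i≢p → f⇒g (F.suc i) (i≢p ∘ suc-injective)))
... | false | true  = m≤n⇒m≤1+n (count-mono-except _ _ p (λ i i≢p → f⇒g (F.suc i) (i≢p ∘ suc-injective)))
... | false | false = count-mono-except _ _ p (λ i i≢p → f⇒g (F.suc i) (i≢p ∘ suc-injective))
... | true  | false with trans (sym (f⇒g F.zero (λ ()) f0)) g0
...   | ()

sumFin-mono : ∀ {n} (f g : Fin n → ℕ) → (∀ i → f i ≤ g i) → sumFin f ≤ sumFin g
sumFin-mono {zero}  f g f≤g = z≤n
sumFin-mono {suc n} f g f≤g =
  +-mono-≤ (f≤g F.zero) (sumFin-mono _ _ (λ i → f≤g (F.suc i)))

sumFin-zero : ∀ {n} (f : Fin n → ℕ) → (∀ i → f i ≡ 0) → sumFin f ≡ 0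
sumFin-zero {zero}  f zero-at = refl
sumFin-zero {suc n} f zero-at rewrite zero-at F.zero =
  sumFin-zero (λ i → f (F.suc i)) (λ i → zero-at (F.suc i))

sumFin-+ : ∀ {n} (f g : Fin n → ℕ) → sumFin (λ i → f i + g i) ≡ sumFin f + sumFin g
sumFin-+ {zero}  f g = refl
sumFin-+ {suc n} f g = begin
  (f F.zero + g F.zero) + sumFin (λ i → f (F.suc i) + g (F.suc i))
    ≡⟨ cong ((f F.zero + g F.zero) +_) (sumFin-+ (λ i → f (F.suc i)) (λ i → g (F.suc i))) ⟩
  (f F.zero + g F.zero) + (sumFin (λ i → f (F.suc i)) + sumFin (λ i → g (F.suc i)))
    ≡⟨ interchange (f F.zero) (g F.zero) _ _ ⟩
  sumFin f + sumFin g ∎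
  where open ≡-Reasoning

sumFin-indicator : ∀ {n} (f : Fin n → ℕ) (p : Fin n) →
                   f p ≡ 1 → (∀ i → i ≢ p → f i ≡ 0) → sumFin f ≡ 1
sumFin-indicator {suc n} f F.zero    at-p off-p =
  cong₂ _+_ at-p (sumFin-zero _ (λ i → off-p (F.suc i) λ ()))
sumFin-indicator {suc n} f (F.suc p) at-p off-p rewrite off-p F.zero (λ ()) =
  sumFin-indicator (λ i → f (F.suc i)) p at-p (λ i i≢p → off-p (F.suc i) (i≢p ∘ suc-injective))

point : ∀ {n} → Fin n → Fin n → ℕ
point p = upd (λ _ → 0) p 1

point-at : ∀ {n} {i p : Fin n} → i ≡ p → point p i ≡ 1
point-at {i = i} {p} i≡p with i ≟ p
... | yes _   = refl
... | no i≢p  = ⊥-elim (i≢p i≡p)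

point-off : ∀ {n} {i p : Fin n} → i ≢ p → point p i ≡ 0
point-off {i = i} {p} i≢p with i ≟ p
... | yes i≡p = ⊥-elim (i≢p i≡p)
... | no _    = refl

sumFin-point : ∀ {n} (p : Fin n) → sumFin (point p) ≡ 1
sumFin-point p = sumFin-indicator (point p) p (point-at refl) (λ i → point-off)

∸-shift : ∀ e d d' k → d ≤ d' + k → e ∸ d' ≤ (e ∸ d) + k
∸-shift e d d' k d≤d'+k = m≤n+o⇒m∸n≤o e d' (begin
  e                   ≤⟨ m≤n+m∸n e d ⟩
  d + (e ∸ d)         ≤⟨ +-monoˡ-≤ (e ∸ d) d≤d'+k ⟩
  d' + k + (e ∸ d)    ≡⟨ +-assoc d' k (e ∸ d) ⟩
  d' + (k + (e ∸ d))  ≡⟨ cong (d' +_) (+-comm k (e ∸ d)) ⟩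
  d' + ((e ∸ d) + k)  ∎)
  where open ≤-Reasoning

edge-test : ∀ {n} (a c u v : Fin n) →
            T ((⌊ a ≟ u ⌋ ∧ ⌊ c ≟ v ⌋) ∨ (⌊ a ≟ v ⌋ ∧ ⌊ c ≟ u ⌋)) →
            (a ≡ u × c ≡ v) ⊎ (a ≡ v × c ≡ u)
edge-test a c u v t with to (T-∨ {⌊ a ≟ u ⌋ ∧ ⌊ c ≟ v ⌋}) t
... | inj₁ t₁ = let (p , q) = to (T-∧ {⌊ a ≟ u ⌋}) t₁ in
                inj₁ (toWitness {a? = a ≟ u} p , toWitness {a? = c ≟ v} q)
... | inj₂ t₂ = let (p , q) = to (T-∧ {⌊ a ≟ v ⌋}) t₂ in
                inj₂ (toWitness {a? = a ≟ v} p , toWitness {a? = c ≟ u} q)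

setEdge-keeps : ∀ {n} (G : Adj n) u v b a c → G a c ≡ true →
                ¬ (a ≡ u × c ≡ v) → ¬ (a ≡ v × c ≡ u) → setEdge G u v b a c ≡ true
setEdge-keeps G u v b a c e ¬uv ¬vu
  with (⌊ a ≟ u ⌋ ∧ ⌊ c ≟ v ⌋) ∨ (⌊ a ≟ v ⌋ ∧ ⌊ c ≟ u ⌋) in test
... | false = e
... | true with edge-test a c u v (from T-≡ test)
...   | inj₁ uv = ⊥-elim (¬uv uv)
...   | inj₂ vu = ⊥-elim (¬vu vu)

deg-insert : ∀ {n} (G : Adj n) u v a → deg G a ≤ deg (setEdge G u v true) a
deg-insert G u v a = count-mono (G a) (setEdge G u v true a) keeps
  where
  keeps : ∀ c → G a c ≡ true → setEdge G u v true a c ≡ true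
  keeps c e with (⌊ a ≟ u ⌋ ∧ ⌊ c ≟ v ⌋) ∨ (⌊ a ≟ v ⌋ ∧ ⌊ c ≟ u ⌋)
  ... | true  = refl
  ... | false = e

-- Deleting the edge uv changes the row of an endpoint a only at the other
-- endpoint w, so it lowers deg a by at most one.
deg-delete-endpoint : ∀ {n} (G : Adj n) u v a w → (a ≡ u × w ≡ v) ⊎ (a ≡ v × w ≡ u) →
                      deg G a ≤ suc (deg (setEdge G u v false) a)
deg-delete-endpoint G u v a w ends = count-mono-except _ _ w keep
  where
  keep : ∀ c → c ≢ w → G a c ≡ true → setEdge G u v false a c ≡ true
  keep c c≢w e = setEdge-keeps G u v false a c e (not-edge ends) (not-edge (swap ends))
    where
    swap : ∀ {x y z : Set} → (x × y) ⊎ z → z ⊎ (x × y)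
    swap (inj₁ p) = inj₂ p
    swap (inj₂ q) = inj₁ q
    not-edge : ∀ {x y} → (a ≡ x × w ≡ y) ⊎ (a ≡ y × w ≡ x) → ¬ (a ≡ x × c ≡ y)
    not-edge (inj₁ (_ , w≡y))   (_ , c≡y)   = c≢w (trans c≡y (sym w≡y))
    not-edge (inj₂ (a≡y , w≡x)) (a≡x , c≡y) =
      c≢w (trans c≡y (trans (sym a≡y) (trans a≡x (sym w≡x))))

deg-delete : ∀ {n} (G : Adj n) u v a →
             deg G a ≤ deg (setEdge G u v false) a + (point u a + point v a)
deg-delete G u v a = by-cases (a ≟ u) (a ≟ v)
  where
  open ≤-Reasoning
  G' = setEdge G u v false
  by-cases : Dec (a ≡ u) → Dec (a ≡ v) → deg G a ≤ deg G' a + (point u a + point v a)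
  by-cases (yes a≡u) _ = begin
    deg G a                            ≤⟨ deg-delete-endpoint G u v a v (inj₁ (a≡u , refl)) ⟩
    suc (deg G' a)                     ≡⟨ +-comm 1 (deg G' a) ⟩
    deg G' a + 1                       ≡⟨ cong (deg G' a +_) (sym (point-at a≡u)) ⟩
    deg G' a + point u a               ≤⟨ +-monoʳ-≤ (deg G' a) (m≤m+n (point u a) (point v a)) ⟩
    deg G' a + (point u a + point v a) ∎
  by-cases (no a≢u) (yes a≡v) = begin
    deg G a                            ≤⟨ deg-delete-endpoint G u v a u (inj₂ (a≡v , refl)) ⟩
    suc (deg G' a)                     ≡⟨ +-comm 1 (deg G' a) ⟩
    deg G' a + 1                       ≡⟨ cong (deg G' a +_) (sym (cong₂ _+_ (point-off a≢u) (point-at a≡v))) ⟩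
    deg G' a + (point u a + point v a) ∎
  by-cases (no a≢u) (no a≢v) = begin
    deg G a                            ≤⟨ count-mono _ _ (λ c e → setEdge-keeps G u v false a c e
                                            (λ (a≡u , _) → a≢u a≡u) (λ (a≡v , _) → a≢v a≡v)) ⟩
    deg G' a                           ≡⟨ +-comm 0 (deg G' a) ⟩
    deg G' a + 0                       ≡⟨ cong (deg G' a +_) (sym (cong₂ _+_ (point-off a≢u) (point-off a≢v))) ⟩
    deg G' a + (point u a + point v a) ∎

potential : ∀ {n Δ} → St n Δ → ℕ
potential s = sumFin (λ a → ecost s a ∸ deg (adj s) a)

potential-recol : ∀ {n Δ} (s : St n Δ) x L c k → k ≤ deg (adj s) x →
                  potential (recol (setLevel s x L) x c k) ≤ potential s
potential-recol s x L c k k≤deg = sumFin-mono _ _ term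
  where
  term : ∀ a → (if ⌊ a ≟ x ⌋ then k else ecost s a) ∸ deg (adj s) a
             ≤ ecost s a ∸ deg (adj s) a
  term a with a ≟ x
  ... | yes refl = ≤-trans (≤-reflexive (m≤n⇒m∸n≡0 k≤deg)) z≤n
  ... | no _     = ≤-refl

phi≤deg : ∀ {n Δ} (s : St n Δ) x K → phiE s x K ≤ deg (adj s) x
phi≤deg s x K = count-mono _ (adj s x) (λ c e → and-left (adj s x c) e)
  where
  and-left : ∀ (a : Bool) {b} → (a ∧ b) ≡ true → a ≡ true
  and-left true _ = refl

-- The cost 3^ℓ' of a rand-color epoch is at most deg x: level ℓ'-1 was
-- not admissible (it is either the old level or strictly between the old
-- level and ℓ'), so 3^ℓ' ≤ 3^(ℓ'+1) ≤ φ_x(ℓ') ≤ deg x.  Levels are stored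
-- shifted by one, so the stored new level is L' = ℓ'+1 and m = ℓ'.
rand-cost≤deg : ∀ {n Δ} (s : St n Δ) x (L' : ℕ) → ¬ Ok s x (lvl s x) → lvl s x < L' →
                (∀ m → lvl s x < m → m < L' → ¬ Ok s x m) → 3 ^ (L' ∸ 1) ≤ deg (adj s) x
rand-cost≤deg s x (suc m) old-bad (s≤s lvl≤m) between-bad =
  ≤-trans (m≤n*m (3 ^ m) 3) (≤-trans (≮⇒≥ m-bad) (phi≤deg s x (suc m)))
  where
  m-bad : ¬ Ok s x m
  m-bad with m ℕ.≟ lvl s x
  ... | yes refl = old-bad
  ... | no m≢lvl = between-bad m (≤∧≢⇒< lvl≤m (λ e → m≢lvl (sym e))) (n<1+n m)

potential-chain : ∀ {n Δ} {s : St n Δ} {x s'} → Chain s x s' → potential s' ≤ potential s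
potential-chain {s = s} {x} (chDet (detS c _ _)) = potential-recol s x 0 c 0 z≤n
potential-chain {s = s} {x} (chStop (randBlank L' c old-bad lt _ between-bad _)) =
  potential-recol s x L' c _ (rand-cost≤deg s x L' old-bad lt between-bad)
potential-chain {s = s} {x} (chGo (randUnique L' c _ old-bad lt _ between-bad _ _ _ _) ch) =
  ≤-trans (potential-chain ch)
          (potential-recol s x L' c _ (rand-cost≤deg s x L' old-bad lt between-bad))

potential-insert : ∀ {n Δ} (s : St n Δ) u v → potential (withEdge s u v true) ≤ potential s
potential-insert s u v =
  sumFin-mono _ _ (λ a → ∸-monoʳ-≤ (ecost s a) (deg-insert (adj s) u v a))

-- A deletion raises the terms of its two endpoints by at most one each.
potential-delete : ∀ {n Δ} (s : St n Δ) u v →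
                   potential (withEdge s u v false) ≤ potential s + 2
potential-delete s u v = begin
  potential (withEdge s u v false)
    ≤⟨ sumFin-mono _ _ (λ a → ∸-shift (ecost s a) (deg (adj s) a) (deg G' a) _ (deg-delete (adj s) u v a)) ⟩
  sumFin (λ a → (ecost s a ∸ deg (adj s) a) + (point u a + point v a))
    ≡⟨ sumFin-+ (λ a → ecost s a ∸ deg (adj s) a) (λ a → point u a + point v a) ⟩
  potential s + sumFin (λ a → point u a + point v a)
    ≡⟨ cong (potential s +_) (trans (sumFin-+ (point u) (point v))
                                    (cong₂ _+_ (sumFin-point u) (sumFin-point v))) ⟩
  potential s + 2 ∎
  where open ≤-Reasoning
        G' = setEdge (adj s) u v false

chain-adj : ∀ {n Δ} {s : St n Δ} {x s'} → Chain s x s' → adj s' ≡ adj s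
chain-adj (chDet (detS _ _ _))                         = refl
chain-adj (chStop (randBlank _ _ _ _ _ _ _))             = refl
chain-adj (chGo (randUnique _ _ _ _ _ _ _ _ _ _ _) ch) = chain-adj ch

run-adj : ∀ {n Δ} {s : St n Δ} {us s'} → Run s us s' → adj s' ≡ foldl applyU (adj s) us
run-adj done          = refl
run-adj (delR r)      = run-adj r
run-adj (insDiff _ r) = run-adj r
run-adj {us = _ ∷ us} (insSameU _ _ ch r) =
  trans (run-adj r) (cong (λ G → foldl applyU G us) (chain-adj ch))
run-adj {us = _ ∷ us} (insSameV _ _ ch r) =
  trans (run-adj r) (cong (λ G → foldl applyU G us) (chain-adj ch))

potential-insert-chain : ∀ {n Δ} (s : St n Δ) u v {x s₁} →
                         Chain (withEdge s u v true) x s₁ → potential s₁ ≤ potential s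
potential-insert-chain s u v ch = ≤-trans (potential-chain ch) (potential-insert s u v)

add-step : ∀ {a b c} t → a ≤ b + 2 → c ≤ a + 2 * t → c ≤ b + 2 * suc t
add-step {a} {b} {c} t a≤b+2 c≤a+2t = begin
  c                ≤⟨ c≤a+2t ⟩
  a + 2 * t        ≤⟨ +-monoˡ-≤ (2 * t) a≤b+2 ⟩
  b + 2 + 2 * t    ≡⟨ +-assoc b 2 (2 * t) ⟩
  b + (2 + 2 * t)  ≡⟨ cong (b +_) (sym (*-suc 2 t)) ⟩
  b + 2 * suc t    ∎
  where open ≤-Reasoning

potential-run : ∀ {n Δ} {s : St n Δ} {us s'} → Run s us s' →
                potential s' ≤ potential s + 2 * length us
potential-run done = ≤-reflexive (sym (+-identityʳ _))
potential-run {s = s} {del u v ∷ us} (delR r) =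
  add-step (length us) (potential-delete s u v) (potential-run r)
potential-run {s = s} {ins u v ∷ us} (insDiff _ r) =
  add-step (length us) (≤-trans (potential-insert s u v) (m≤m+n _ 2)) (potential-run r)
potential-run {s = s} {ins u v ∷ us} (insSameU _ _ ch r) =
  add-step (length us) (≤-trans (potential-insert-chain s u v ch) (m≤m+n _ 2)) (potential-run r)
potential-run {s = s} {ins u v ∷ us} (insSameV _ _ ch r) =
  add-step (length us) (≤-trans (potential-insert-chain s u v ch) (m≤m+n _ 2)) (potential-run r)

potential-init : ∀ {n Δ} (col0 : Fin n → Fin (suc Δ)) → potential (initSt col0) ≡ 0
potential-init {n} col0 = sumFin-zero _ (λ a → 0∸n≡0 (deg (emptyG {n}) a))

finalCost≤potential : ∀ {n Δ} (s : St n Δ) → (∀ a b → adj s a b ≡ false) →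
                      finalCost s ≤ potential s
finalCost≤potential s no-edges =
  sumFin-mono _ _ (λ a → ≤-reflexive (cong (ecost s a ∸_) (sym (count-none _ (no-edges a)))))

lemma5 : Σ ℕ λ C → ∀ (n Δ : ℕ) → 0 < Δ →
           (us : List (Update n)) → Valid Δ emptyG us → EndsEmpty us →
           (col0 : Fin n → Fin (suc Δ)) (s : St n Δ) →
           Run (initSt col0) us s → finalCost s ≤ C * length us
lemma5 = 2 , λ n Δ _ us _ ends-empty col0 s r → begin
  finalCost s                                ≤⟨ finalCost≤potential s (λ a b →
                                                  trans (cong (λ G → G a b) (run-adj r)) (ends-empty a b)) ⟩
  potential s                                ≤⟨ potential-run r ⟩
  potential (initSt col0) + 2 * length us    ≡⟨ cong (_+ 2 * length us) (potential-init col0) ⟩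
  2 * length us                              ∎
  where open ≤-Reasoning
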